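{- Let $G$ be a finite simple graph of order $n$. Then $\alpha_1'(G) \le \left\lfloor \frac{n+1}{2} \right\rfloor$, with equality if and only if $G$ is a faithful graph.
   Context: All graphs are finite, simple and undirected. For a graph $G$, a $1$-nearly edge independent set of $G$ is a set $M \subseteq E(G)$ such that $M$ contains exactly one (unordered) pair of distinct edges that are adjacent in $G$ (i.e. share a common end vertex). The $1$-nearly edge independence number $\alpha_1'(G)$ is the maximum cardinality of a $1$-nearly edge independent set of $G$, taken to be $0$ if $G$ has no such set. A graph $G$ of order $n$ is called faithful if $G$ has a spanning subgraph $F$ (a subgraph with vertex set $V(G)$) that is a forest isomorphic to $P_3 \cup \frac{n-3}{2}K_2$ if $n$ is odd, and to $P_3 \cup \frac{n-4}{2}K_2 \cup K_1$ if $n$ is even. Here $P_3$ is the path on $3$ vertices, $K_m$ the complete graph on $m$ vertices, $tH$ the disjoint union of $t$ copies of $H$, and $\cup$ disjoint union. -}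

module Defs where

open import Data.Nat using (ℕ; zero; suc; _+_; _<_; _≤_; _≡ᵇ_; _%_; ⌊_/2⌋)
open import Data.Bool using (Bool; true; false; _∧_; _∨_)
open import Data.Fin using (Fin; toℕ)
open import Data.Product using (_×_; _,_; proj₁; proj₂; Σ; ∃; ∃-syntax)
open import Data.Sum using (_⊎_)
open import Data.List using (List; length; lookup)
open import Data.List.Relation.Unary.All using (All)
open import Data.List.Relation.Unary.Unique.Propositional using (Unique)
open import Relation.Binary.PropositionalEquality using (_≡_; _≢_)
open import Relation.Nullary using (¬_)
open import Function.Bundles using (_↔_; Inverse)

record Graph (n : ℕ) : Set where
  field
    adj   : Fin n → Fin n → Bool
    sym   : ∀ u v → adj u v ≡ adj v u
    irrefl : ∀ u → adj u u ≡ false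
open Graph public

-- An edge {u,v} is represented canonically as the pair (u , v) with toℕ u < toℕ v.
Edge : ℕ → Set
Edge n = Fin n × Fin n

IsEdgeOf : ∀ {n} → Graph n → Edge n → Set
IsEdgeOf G (u , v) = (toℕ u < toℕ v) × (adj G u v ≡ true)

IsEdgeSet : ∀ {n} → Graph n → List (Edge n) → Set
IsEdgeSet G M = All (IsEdgeOf G) M × Unique M

AdjacentEdges : ∀ {n} → Edge n → Edge n → Set
AdjacentEdges e f =
  e ≢ f ×
  (proj₁ e ≡ proj₁ f ⊎ proj₁ e ≡ proj₂ f ⊎ proj₂ e ≡ proj₁ f ⊎ proj₂ e ≡ proj₂ f)

ExactlyOneAdjacentPair : ∀ {n} → List (Edge n) → Set
ExactlyOneAdjacentPair M =
  Σ (Fin (length M)) λ i → Σ (Fin (length M)) λ j →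
    (toℕ i < toℕ j) × AdjacentEdges (lookup M i) (lookup M j) ×
    (∀ i' j' → toℕ i' < toℕ j' → AdjacentEdges (lookup M i') (lookup M j') →
       (i' ≡ i) × (j' ≡ j))

NearlyIndep : ∀ {n} → Graph n → List (Edge n) → Set
NearlyIndep G M = IsEdgeSet G M × ExactlyOneAdjacentPair M

IsAlpha1 : ∀ {n} → Graph n → ℕ → Set
IsAlpha1 G k =
  (Σ (List (Edge _)) λ M → NearlyIndep G M × length M ≡ k ×
      (∀ M' → NearlyIndep G M' → length M' ≤ k))
  ⊎ ((∀ M → ¬ NearlyIndep G M) × k ≡ 0)

-- The forest P₃ ∪ ((n-3)/2)K₂ (n odd) or P₃ ∪ ((n-4)/2)K₂ ∪ K₁ (n even),
-- on vertices 0..n-1: path 0-1-2, edges {3,4},{5,6},..., and (n even) vertex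
-- n-1 isolated.  (Only meaningful for n ≥ 3.)
forestEdgeℕ : ℕ → ℕ → Bool
forestEdgeℕ a b =
  ((a ≡ᵇ 0) ∧ (b ≡ᵇ 1)) ∨ ((a ≡ᵇ 1) ∧ (b ≡ᵇ 2)) ∨
  ((a % 2 ≡ᵇ 1) ∧ (Data.Nat._<ᵇ_ 2 a) ∧ (b ≡ᵇ suc a))
  where import Data.Nat

forestAdj : (n : ℕ) → Fin n → Fin n → Bool
forestAdj n u v = forestEdgeℕ (toℕ u) (toℕ v) ∨ forestEdgeℕ (toℕ v) (toℕ u)

SpanningSubgraph : ∀ {n} → Graph n → Graph n → Set
SpanningSubgraph F G = ∀ u v → adj F u v ≡ true → adj G u v ≡ true

-- Faithful: G has a spanning subgraph isomorphic to the forest above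
-- (which requires n ≥ 3 for the forest to exist).
Faithful : ∀ {n} → Graph n → Set
Faithful {n} G =
  (3 ≤ n) ×
  Σ (Graph n) λ F → SpanningSubgraph F G ×
    Σ (Fin n ↔ Fin n) λ σ →
      ∀ u v → adj F (Inverse.to σ u) (Inverse.to σ v) ≡ forestAdj n u v

{-# OPTIONS --safe #-}
-- A 1-nearly edge independent set M consists of two edges e, f sharing a vertex s together with
-- a matching R of |M| - 2 edges that is vertex-disjoint from e and f (any other shared vertex would
-- give a second adjacent pair). Listing the path a s b = e ∪ f and then the edges of R pair by pair
-- gives 2|M| - 1 distinct vertices, so |M| ≤ ⌊(n+1)/2⌋. In this order M is exactly the forest
-- P₃ ∪ tK₂ of the faithful definition laid on positions 0, 1, 2, …; at equality at most one
-- vertex is left over, and it plays the isolated K₁, so G is faithful. Conversely, the path and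
-- the pairs of a spanning copy of that forest form a 1-nearly edge independent set of size
-- ⌊(n+1)/2⌋.
module Submission where

open import Defs hiding (sym)
open import Data.Bool using (true; false; _∨_)
open import Data.Bool.Properties using (∨-comm; ∧-conicalʳ; ¬-not; T-≡)
open import Data.Empty using (⊥)
open import Data.Fin using (Fin; zero; suc; toℕ; inject₁)
open import Data.Fin.Properties
  using (toℕ-injective; toℕ-inject₁; injective⇒≤; ¬∀⟶∃¬; <-cmp; <⇒≢; <-trans; ≤∧≢⇒<; _<?_; _≟_)
open import Data.List using (List; []; _∷_; [_]; _++_; length; lookup; tabulate)
open import Data.List.Properties using (tabulate-lookup; length-tabulate; length-++; ++-identityʳ)
open import Data.List.Membership.Propositional using (_∈_; _∉_)
open import Data.List.Membership.Propositional.Properties using (∈-lookup; ∈-∃++; ∈-tabulate⁻)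
open import Data.List.Relation.Binary.Permutation.Propositional
  using (_↭_; ↭-trans; ↭-prep; ↭-sym; ↭⇒↭ₛ)
open import Data.List.Relation.Binary.Permutation.Propositional.Properties
  using (∈-resp-↭; ↭-length; shift)
import Data.List.Relation.Binary.Permutation.Setoid.Properties as Permutationₛ
open import Data.List.Relation.Unary.All as All using (All; []; _∷_)
open import Data.List.Relation.Unary.All.Properties using (¬Any⇒All¬; All¬⇒¬Any)
open import Data.List.Relation.Unary.AllPairs using ([]; _∷_)
open import Data.List.Relation.Binary.Disjoint.Propositional using (Disjoint)
open import Data.List.Relation.Unary.Any using (here; there; index; any?)
open import Data.List.Relation.Unary.Any.Properties using (lookup-index)
open import Data.List.Relation.Unary.Unique.Propositional using (Unique)
open import Data.List.Relation.Unary.Unique.Propositional.Properties using (++⁺; tabulate⁺)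
open import Data.Nat using (ℕ; zero; suc; _+_; _≤_; _<_; z≤n; s≤s; z<s; ⌊_/2⌋)
import Data.Nat.Properties as ℕ
open import Data.Product using (∃; ∃-syntax; _×_; _,_; proj₁; proj₂)
open import Data.Sum using (_⊎_; inj₁; inj₂)
import Data.Sum as Sum
open import Data.Unit using (⊤; tt)
open import Function using (_∘_; id)
open import Function.Bundles using (_⇔_; _↔_; Equivalence; Injection; Inverse; mk↔ₛ′; mk⇔)
open import Function.Definitions using (Injective)
open import Function.Properties.Inverse using (↔⇒↣)
open import Relation.Binary using (tri<; tri≈; tri>)
open import Relation.Binary.PropositionalEquality
  using (_≡_; _≢_; refl; sym; trans; cong; cong₂; subst; subst₂; setoid)
open import Relation.Nullary using (¬_; yes; no; contradiction)

Adj : ∀ {n} → Graph n → Fin n → Fin n → Set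
Adj G u v = adj G u v ≡ true

Adj-sym : ∀ {n} (G : Graph n) {u v} → Adj G u v → Adj G v u
Adj-sym G {u} {v} = trans (Graph.sym G v u)

∨-true : ∀ {x y} → x ∨ y ≡ true → x ≡ true ⊎ y ≡ true
∨-true {true}  _      = inj₁ refl
∨-true {false} y≡true = inj₂ y≡true

-- Duplicate-free lists

lookup-injective : ∀ {A : Set} {xs : List A} → Unique xs → Injective _≡_ _≡_ (lookup xs)
lookup-injective (_ ∷ _)         {zero}  {zero}  _  = refl
lookup-injective (x≢xs ∷ _)      {zero}  {suc j} eq = contradiction eq (All.lookup x≢xs (∈-lookup j))
lookup-injective (x≢xs ∷ _)      {suc i} {zero}  eq = contradiction (sym eq) (All.lookup x≢xs (∈-lookup i))
lookup-injective (_ ∷ xs-unique) {suc i} {suc j} eq = cong suc (lookup-injective xs-unique eq)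

Unique-resp-↭ : ∀ {A : Set} {xs ys : List A} → xs ↭ ys → Unique xs → Unique ys
Unique-resp-↭ xs↭ys = Permutationₛ.Unique-resp-↭ (setoid _) (↭⇒↭ₛ xs↭ys)

∈⇒↭∷ : ∀ {A : Set} {x : A} {xs} → x ∈ xs → ∃[ ys ] xs ↭ x ∷ ys
∈⇒↭∷ x∈xs with ys , zs , refl ← ∈-∃++ x∈xs = ys ++ zs , shift _ ys zs

∈∈⇒↭∷∷ : ∀ {A : Set} {x y : A} {xs} → x ∈ xs → y ∈ xs → x ≢ y → ∃[ zs ] xs ↭ x ∷ y ∷ zs
∈∈⇒↭∷∷ {x = x} x∈xs y∈xs x≢y with ys , xs↭x∷ys ← ∈⇒↭∷ x∈xs | ∈-resp-↭ xs↭x∷ys y∈xs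
... | here y≡x = contradiction (sym y≡x) x≢y
... | there y∈ys with zs , ys↭y∷zs ← ∈⇒↭∷ y∈ys = zs , ↭-trans xs↭x∷ys (↭-prep x ys↭y∷zs)

module _ {n : ℕ} where

  unique⇒length≤ : {xs : List (Fin n)} → Unique xs → length xs ≤ n
  unique⇒length≤ xs-unique = injective⇒≤ (lookup-injective xs-unique)

  covering⇒length≥ : {xs : List (Fin n)} → (∀ x → x ∈ xs) → n ≤ length xs
  covering⇒length≥ {xs} cover = injective⇒≤ {f = index ∘ cover} λ {x} {y} eq →
    trans (lookup-index (cover x)) (trans (cong (lookup xs) eq) (sym (lookup-index (cover y))))

  length<⇒∃∉ : {xs : List (Fin n)} → length xs < n → ∃ (_∉ xs)
  length<⇒∃∉ {xs} short =
    ¬∀⟶∃¬ n (_∈ xs) (λ x → any? (x ≟_) xs) (ℕ.<⇒≱ short ∘ covering⇒length≥)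

  unique∧length≡⇒covering : {xs : List (Fin n)} → Unique xs → length xs ≡ n → ∀ x → x ∈ xs
  unique∧length≡⇒covering {xs} xs-unique full x with any? (x ≟_) xs
  ... | yes x∈xs = x∈xs
  ... | no  x∉xs = contradiction
    (subst (λ m → suc m ≤ n) full (unique⇒length≤ (¬Any⇒All¬ xs x∉xs ∷ xs-unique))) ℕ.1+n≰n

forestEdge⇒suc : ∀ c d → forestEdgeℕ c d ≡ true → d ≡ suc c
forestEdge⇒suc 0 1 _ = refl
forestEdge⇒suc 0 0 ()
forestEdge⇒suc 0 (suc (suc d)) ()
forestEdge⇒suc 1 2 _ = refl
forestEdge⇒suc 1 0 ()
forestEdge⇒suc 1 1 ()
forestEdge⇒suc 1 (suc (suc (suc d))) ()
forestEdge⇒suc 2 d ()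
forestEdge⇒suc (suc (suc (suc c))) d h =
  ℕ.≡ᵇ⇒≡ d (4 + c) (Equivalence.from T-≡ (∧-conicalʳ _ _ h))

forestAdj-irrefl : ∀ {n} (u : Fin n) → forestAdj n u u ≡ false
forestAdj-irrefl u = cong (λ b → b ∨ b) (¬-not (ℕ.1+n≢n ∘ sym ∘ forestEdge⇒suc (toℕ u) (toℕ u)))

-- The forest of forestAdj read off list positions: the path x₀x₁x₂ and the pairs x₃x₄, x₅x₆, …;
-- a trailing unpaired vertex is the isolated K₁.
module _ {A : Set} (_~_ : A → A → Set) where

  PairedBy : List A → Set
  PairedBy (x ∷ y ∷ zs) = x ~ y × PairedBy zs
  PairedBy _            = ⊤

  ForestAlong : List A → Set
  ForestAlong (a ∷ s ∷ b ∷ zs) = a ~ s × s ~ b × PairedBy zs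
  ForestAlong _                = ⊥

module _ {A : Set} {_~_ : A → A → Set} where

  forestAlong⇒3≤length : {xs : List A} → ForestAlong _~_ xs → 3 ≤ length xs
  forestAlong⇒3≤length {_ ∷ _ ∷ _ ∷ _} _ = s≤s (s≤s (s≤s z≤n))

  pairedBy-short : {xs : List A} → length xs ≤ 1 → PairedBy _~_ xs
  pairedBy-short {[]}         _ = tt
  pairedBy-short {_ ∷ []}     _ = tt
  pairedBy-short {_ ∷ _ ∷ _} (s≤s ())

  pairedBy-tabulate⁺ : ∀ {m} {g : Fin m → A} →
    (∀ i j → forestEdgeℕ (3 + toℕ i) (3 + toℕ j) ≡ true → g i ~ g j) → PairedBy _~_ (tabulate g)
  pairedBy-tabulate⁺ {zero}        _     = tt
  pairedBy-tabulate⁺ {suc zero}    _     = tt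
  pairedBy-tabulate⁺ {suc (suc m)} edges =
    edges zero (suc zero) refl , pairedBy-tabulate⁺ (λ i j → edges (suc (suc i)) (suc (suc j)))

  forestAlong-tabulate⁺ : ∀ {n} {f : Fin n → A} → 3 ≤ n →
    (∀ u v → forestEdgeℕ (toℕ u) (toℕ v) ≡ true → f u ~ f v) → ForestAlong _~_ (tabulate f)
  forestAlong-tabulate⁺ {suc (suc (suc n))} _ edges =
    edges zero (suc zero) refl , edges (suc zero) (suc (suc zero)) refl ,
    pairedBy-tabulate⁺ (λ i j → edges (suc (suc (suc i))) (suc (suc (suc j))))
  forestAlong-tabulate⁺ {1} (s≤s ())       _
  forestAlong-tabulate⁺ {2} (s≤s (s≤s ())) _

  pairedBy-tabulate⁻ : ∀ {m} (g : Fin (suc m) → A) → PairedBy _~_ (tabulate g) →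
    ∀ i → forestEdgeℕ (3 + toℕ (inject₁ i)) (3 + toℕ (suc i)) ≡ true → g (inject₁ i) ~ g (suc i)
  pairedBy-tabulate⁻ g (g₀~g₁ , _)  zero          _  = g₀~g₁
  pairedBy-tabulate⁻ g _            (suc zero)    ()
  pairedBy-tabulate⁻ g (_ , paired) (suc (suc i)) h  =
    pairedBy-tabulate⁻ (λ i → g (suc (suc i))) paired i h

  forestAlong-tabulate-consecutive : ∀ {n} (f : Fin (suc n) → A) → ForestAlong _~_ (tabulate f) →
    ∀ i → forestEdgeℕ (toℕ (inject₁ i)) (toℕ (suc i)) ≡ true → f (inject₁ i) ~ f (suc i)
  forestAlong-tabulate-consecutive {0}           f ()
  forestAlong-tabulate-consecutive {1}           f ()
  forestAlong-tabulate-consecutive {suc (suc _)} f (a~s , _ , _)    zero                _ = a~s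
  forestAlong-tabulate-consecutive {suc (suc _)} f (_ , s~b , _)    (suc zero)          _ = s~b
  forestAlong-tabulate-consecutive {suc (suc _)} f _                (suc (suc zero))    ()
  forestAlong-tabulate-consecutive {suc (suc _)} f (_ , _ , paired) (suc (suc (suc i))) h =
    pairedBy-tabulate⁻ (λ i → f (suc (suc (suc i)))) paired i h

  -- Every forest edge joins consecutive positions, so only the pairs (inject₁ v, suc v) matter.
  forestAlong-tabulate⁻ : ∀ {n} (f : Fin n → A) → ForestAlong _~_ (tabulate f) →
    ∀ u v → forestEdgeℕ (toℕ u) (toℕ v) ≡ true → f u ~ f v
  forestAlong-tabulate⁻ f along u zero h = contradiction (forestEdge⇒suc (toℕ u) 0 h) ℕ.0≢1+n
  forestAlong-tabulate⁻ f along u (suc v) h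
    with refl ← toℕ-injective {i = u} {j = inject₁ v}
                  (trans (ℕ.suc-injective (sym (forestEdge⇒suc (toℕ u) (suc (toℕ v)) h)))
                         (sym (toℕ-inject₁ v)))
    = forestAlong-tabulate-consecutive f along v h

module _ {n : ℕ} (G : Graph n) where

  faithful⇒forestAlong : Faithful G → ∃[ L ] Unique L × length L ≡ n × ForestAlong (Adj G) L
  faithful⇒forestAlong (3≤n , F , F⊆G , σ , F∘σ≡forest) =
    tabulate to , tabulate⁺ (Injection.injective (↔⇒↣ σ)) , length-tabulate to ,
    forestAlong-tabulate⁺ 3≤n edges
    where
    open Inverse σ using (to)
    edges : ∀ u v → forestEdgeℕ (toℕ u) (toℕ v) ≡ true → Adj G (to u) (to v)
    edges u v h = F⊆G (to u) (to v) (trans (F∘σ≡forest u v) (cong (_∨ forestEdgeℕ (toℕ v) (toℕ u)) h))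

  -- Taking m ≡ n as a hypothesis lets lookup L serve as f, since length L ≡ n holds only propositionally.
  embedding⇒faithful : ∀ {m} (f : Fin m → Fin n) → m ≡ n → Injective _≡_ _≡_ f →
    ForestAlong (Adj G) (tabulate f) → Faithful G
  embedding⇒faithful f refl f-injective along =
    subst (3 ≤_) (length-tabulate f) (forestAlong⇒3≤length along) , F , F⊆G , σ ,
    λ u v → cong₂ (forestAdj n) (from∘f u) (from∘f v)
    where
    f-onto : ∀ x → ∃ λ i → x ≡ f i
    f-onto x = ∈-tabulate⁻ (unique∧length≡⇒covering (tabulate⁺ f-injective) (length-tabulate f) x)

    from : Fin n → Fin n
    from = proj₁ ∘ f-onto

    f∘from : ∀ x → f (from x) ≡ x
    f∘from = sym ∘ proj₂ ∘ f-onto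

    from∘f : ∀ i → from (f i) ≡ i
    from∘f i = f-injective (f∘from (f i))

    σ : Fin n ↔ Fin n
    σ = mk↔ₛ′ f from f∘from from∘f

    F : Graph n
    F = record
      { adj    = λ x y → forestAdj n (from x) (from y)
      ; sym    = λ x y → ∨-comm (forestEdgeℕ (toℕ (from x)) (toℕ (from y))) _
      ; irrefl = λ x → forestAdj-irrefl (from x)
      }

    edge-of : ∀ x y → forestEdgeℕ (toℕ (from x)) (toℕ (from y)) ≡ true → Adj G x y
    edge-of x y h =
      subst₂ (Adj G) (f∘from x) (f∘from y) (forestAlong-tabulate⁻ f along (from x) (from y) h)

    F⊆G : SpanningSubgraph F G
    F⊆G x y h = Sum.[ edge-of x y , Adj-sym G ∘ edge-of y x ]′ (∨-true h)

  forestAlong⇒faithful : {L : List (Fin n)} → Unique L → length L ≡ n → ForestAlong (Adj G) L →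
    Faithful G
  forestAlong⇒faithful {L} L-unique full along =
    embedding⇒faithful (lookup L) full (lookup-injective L-unique)
      (subst (ForestAlong (Adj G)) (sym (tabulate-lookup L)) along)

-- Edges and matchings

module _ {n : ℕ} where

  _∈ₑ_ : Fin n → Edge n → Set
  z ∈ₑ e = z ≡ proj₁ e ⊎ z ≡ proj₂ e

  shared⇒adjacent : ∀ {e f z} → e ≢ f → z ∈ₑ e → z ∈ₑ f → AdjacentEdges e f
  shared⇒adjacent e≢f (inj₁ p) (inj₁ q) = e≢f , inj₁ (trans (sym p) q)
  shared⇒adjacent e≢f (inj₁ p) (inj₂ q) = e≢f , inj₂ (inj₁ (trans (sym p) q))
  shared⇒adjacent e≢f (inj₂ p) (inj₁ q) = e≢f , inj₂ (inj₂ (inj₁ (trans (sym p) q)))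
  shared⇒adjacent e≢f (inj₂ p) (inj₂ q) = e≢f , inj₂ (inj₂ (inj₂ (trans (sym p) q)))

  adjacent⇒shared : ∀ {e f} → AdjacentEdges e f → ∃ λ z → z ∈ₑ e × z ∈ₑ f
  adjacent⇒shared {e} (_ , inj₁ p)                = proj₁ e , inj₁ refl , inj₁ p
  adjacent⇒shared {e} (_ , inj₂ (inj₁ p))         = proj₁ e , inj₁ refl , inj₂ p
  adjacent⇒shared {e} (_ , inj₂ (inj₂ (inj₁ p)))  = proj₂ e , inj₂ refl , inj₁ p
  adjacent⇒shared {e} (_ , inj₂ (inj₂ (inj₂ p)))  = proj₂ e , inj₂ refl , inj₂ p

  adjacent-sym : ∀ {e f} → AdjacentEdges e f → AdjacentEdges f e
  adjacent-sym e~f@(e≢f , _) with z , z∈e , z∈f ← adjacent⇒shared e~f =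
    shared⇒adjacent (e≢f ∘ sym) z∈f z∈e

  edge : Fin n → Fin n → Edge n
  edge x y with x <? y
  ... | yes _ = x , y
  ... | no  _ = y , x

  edge-isEdge : (G : Graph n) {x y : Fin n} → x ≢ y → Adj G x y → IsEdgeOf G (edge x y)
  edge-isEdge G {x} {y} x≢y x~y with x <? y
  ... | yes x<y = x<y , x~y
  ... | no  x≮y = ≤∧≢⇒< (ℕ.≮⇒≥ x≮y) (x≢y ∘ sym) , Adj-sym G x~y

  ∈ₑ-edge⁻ : ∀ x y {z} → z ∈ₑ edge x y → z ≡ x ⊎ z ≡ y
  ∈ₑ-edge⁻ x y with x <? y
  ... | yes _ = id
  ... | no  _ = Sum.swap

  ∈ₑ-edge⁺ : ∀ x y {z} → z ≡ x ⊎ z ≡ y → z ∈ₑ edge x y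
  ∈ₑ-edge⁺ x y with x <? y
  ... | yes _ = id
  ... | no  _ = Sum.swap

  IsMatching : List (Edge n) → Set
  IsMatching R = ∀ {g h} → g ∈ R → h ∈ R → ¬ AdjacentEdges g h

  verts : List (Edge n) → List (Fin n)
  verts []      = []
  verts (g ∷ R) = proj₁ g ∷ proj₂ g ∷ verts R

  ∈-verts⁻ : ∀ {R z} → z ∈ verts R → ∃ λ g → g ∈ R × z ∈ₑ g
  ∈-verts⁻ {g ∷ R} (here z≡u)         = g , here refl , inj₁ z≡u
  ∈-verts⁻ {g ∷ R} (there (here z≡v)) = g , here refl , inj₂ z≡v
  ∈-verts⁻ {g ∷ R} (there (there z∈)) with h , h∈R , z∈h ← ∈-verts⁻ z∈ = h , there h∈R , z∈h

  ⌊length-verts/2⌋ : ∀ R → ⌊ length (verts R) /2⌋ ≡ length R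
  ⌊length-verts/2⌋ []      = refl
  ⌊length-verts/2⌋ (_ ∷ R) = cong suc (⌊length-verts/2⌋ R)

  verts-unique : ∀ {R} → All (λ g → proj₁ g ≢ proj₂ g) R → Unique R → IsMatching R → Unique (verts R)
  verts-unique {[]}    _              _                  _        = []
  verts-unique {g ∷ R} (u≢v ∷ proper) (g≢R ∷ R-unique) matching =
    (u≢v ∷ avoids (inj₁ refl)) ∷ avoids (inj₂ refl) ∷
    verts-unique proper R-unique (λ g∈R h∈R → matching (there g∈R) (there h∈R))
    where
    avoids : ∀ {z} → z ∈ₑ g → All (z ≢_) (verts R)
    avoids z∈g = ¬Any⇒All¬ (verts R) λ z∈verts →
      let h , h∈R , z∈h = ∈-verts⁻ z∈verts in
      matching (here refl) (there h∈R) (shared⇒adjacent (All.lookup g≢R h∈R) z∈g z∈h)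

  pairedBy-verts-++ : ∀ {_~_ : Fin n → Fin n → Set} {R ys} →
    All (λ g → proj₁ g ~ proj₂ g) R → PairedBy _~_ ys → PairedBy _~_ (verts R ++ ys)
  pairedBy-verts-++ []           ys-paired = ys-paired
  pairedBy-verts-++ (u~v ∷ R~) ys-paired = u~v , pairedBy-verts-++ R~ ys-paired

-- Structure of 1-nearly edge independent sets

module _ {n : ℕ} {M : List (Edge n)} {i j : Fin (length M)}
  (only : ∀ i′ j′ → toℕ i′ < toℕ j′ → AdjacentEdges (lookup M i′) (lookup M j′) → i′ ≡ i × j′ ≡ j) where

  adjacent-index : ∀ i′ j′ → AdjacentEdges (lookup M i′) (lookup M j′) → i′ ≡ i ⊎ i′ ≡ j
  adjacent-index i′ j′ adjacent with <-cmp i′ j′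
  ... | tri< i′<j′ _ _ = inj₁ (proj₁ (only i′ j′ i′<j′ adjacent))
  ... | tri≈ _ refl _  = contradiction refl (proj₁ adjacent)
  ... | tri> _ _ j′<i′ = inj₂ (proj₂ (only j′ i′ j′<i′ (adjacent-sym adjacent)))

  adjacent-member : ∀ {g h} → g ∈ M → h ∈ M → AdjacentEdges g h → g ≡ lookup M i ⊎ g ≡ lookup M j
  adjacent-member g∈M h∈M g~h =
    Sum.map at at (adjacent-index _ _ (subst₂ AdjacentEdges (lookup-index g∈M) (lookup-index h∈M) g~h))
    where
    at : ∀ {k} → index g∈M ≡ k → _ ≡ lookup M k
    at = trans (lookup-index g∈M) ∘ cong (lookup M)

record Path₃ {n} (G : Graph n) (e f : Edge n) : Set where
  field
    a s b       : Fin n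
    a≢s         : a ≢ s
    a≢b         : a ≢ b
    s≢b         : s ≢ b
    a∈e         : a ∈ₑ e
    s∈e         : s ∈ₑ e
    b∈f         : b ∈ₑ f
    a~s         : Adj G a s
    s~b         : Adj G s b

path₃ : ∀ {n} {G : Graph n} {e f} → IsEdgeOf G e → IsEdgeOf G f → AdjacentEdges e f → Path₃ G e f
path₃ {G = G} {u , v} {u′ , v′} (u<v , u~v) (u′<v′ , u′~v′) (e≢f , inj₁ refl) = record
  { a = v ; s = u ; b = v′
  ; a≢s = <⇒≢ u<v ∘ sym ; a≢b = e≢f ∘ cong (u ,_) ; s≢b = <⇒≢ u′<v′
  ; a∈e = inj₂ refl ; s∈e = inj₁ refl ; b∈f = inj₂ refl
  ; a~s = Adj-sym G u~v ; s~b = u′~v′ }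
path₃ {G = G} {u , v} {u′ , v′} (u<v , u~v) (u′<v′ , u′~v′) (_ , inj₂ (inj₁ refl)) = record
  { a = v ; s = u ; b = u′
  ; a≢s = <⇒≢ u<v ∘ sym ; a≢b = <⇒≢ (<-trans u′<v′ u<v) ∘ sym ; s≢b = <⇒≢ u′<v′ ∘ sym
  ; a∈e = inj₂ refl ; s∈e = inj₁ refl ; b∈f = inj₁ refl
  ; a~s = Adj-sym G u~v ; s~b = Adj-sym G u′~v′ }
path₃ {G = G} {u , v} {u′ , v′} (u<v , u~v) (u′<v′ , u′~v′) (_ , inj₂ (inj₂ (inj₁ refl))) = record
  { a = u ; s = v ; b = v′
  ; a≢s = <⇒≢ u<v ; a≢b = <⇒≢ (<-trans u<v u′<v′) ; s≢b = <⇒≢ u′<v′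
  ; a∈e = inj₁ refl ; s∈e = inj₂ refl ; b∈f = inj₂ refl
  ; a~s = u~v ; s~b = u′~v′ }
path₃ {G = G} {u , v} {u′ , v′} (u<v , u~v) (u′<v′ , u′~v′) (e≢f , inj₂ (inj₂ (inj₂ refl))) = record
  { a = u ; s = v ; b = u′
  ; a≢s = <⇒≢ u<v ; a≢b = e≢f ∘ cong (_, v) ; s≢b = <⇒≢ u′<v′ ∘ sym
  ; a∈e = inj₁ refl ; s∈e = inj₂ refl ; b∈f = inj₁ refl
  ; a~s = u~v ; s~b = Adj-sym G u′~v′ }

record PathAndMatching {n} (G : Graph n) (M : List (Edge n)) : Set where
  field
    a s b        : Fin n
    R            : List (Edge n)
    length-M     : length M ≡ 2 + length R
    spine-unique : Unique (a ∷ s ∷ b ∷ verts R)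
    a~s          : Adj G a s
    s~b          : Adj G s b
    R-edges      : All (λ g → Adj G (proj₁ g) (proj₂ g)) R

  spine : List (Fin n)
  spine = a ∷ s ∷ b ∷ verts R

  length-M≡⌊1+spine/2⌋ : length M ≡ ⌊ suc (length spine) /2⌋
  length-M≡⌊1+spine/2⌋ = trans length-M (cong (2 +_) (sym (⌊length-verts/2⌋ R)))

decompose : ∀ {n} {G : Graph n} {M} → NearlyIndep G M → PathAndMatching G M
decompose {G = G} {M} ((M-edges , M-unique) , i , j , _ , e~f , only)
  with R , M↭e∷f∷R ← ∈∈⇒↭∷∷ (∈-lookup i) (∈-lookup j) (proj₁ e~f)
  with (_ ∷ e≢R) ∷ f≢R ∷ R-unique ← Unique-resp-↭ M↭e∷f∷R M-unique
  = record
  { a = a ; s = s ; b = b ; R = R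
  ; length-M     = ↭-length M↭e∷f∷R
  ; spine-unique = ++⁺ ((a≢s ∷ a≢b ∷ []) ∷ (s≢b ∷ []) ∷ [] ∷ [])
                        (verts-unique R-proper R-unique R-matching) path-avoids-R
  ; a~s = a~s ; s~b = s~b
  ; R-edges      = All.tabulate (proj₂ ∘ All.lookup M-edges ∘ R⊆M)
  }
  where
  open Path₃ (path₃ {G = G} (All.lookup M-edges (∈-lookup i)) (All.lookup M-edges (∈-lookup j)) e~f)

  R⊆M : ∀ {g} → g ∈ R → g ∈ M
  R⊆M = ∈-resp-↭ (↭-sym M↭e∷f∷R) ∘ there ∘ there

  R-isolated : ∀ {g h} → g ∈ R → h ∈ M → ¬ AdjacentEdges g h
  R-isolated g∈R h∈M g~h with adjacent-member only (R⊆M g∈R) h∈M g~h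
  ... | inj₁ refl = All.lookup e≢R g∈R refl
  ... | inj₂ refl = All.lookup f≢R g∈R refl

  R-matching : IsMatching R
  R-matching g∈R h∈R = R-isolated g∈R (R⊆M h∈R)

  R-proper : All (λ g → proj₁ g ≢ proj₂ g) R
  R-proper = All.tabulate (<⇒≢ ∘ proj₁ ∘ All.lookup M-edges ∘ R⊆M)

  R-avoids-e∪f : ∀ {g z} → g ∈ R → z ∈ₑ g → ¬ (z ∈ₑ lookup M i ⊎ z ∈ₑ lookup M j)
  R-avoids-e∪f g∈R z∈g (inj₁ z∈e) =
    R-isolated g∈R (∈-lookup i) (shared⇒adjacent (All.lookup e≢R g∈R ∘ sym) z∈g z∈e)
  R-avoids-e∪f g∈R z∈g (inj₂ z∈f) =
    R-isolated g∈R (∈-lookup j) (shared⇒adjacent (All.lookup f≢R g∈R ∘ sym) z∈g z∈f)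

  path-in-e∪f : All (λ z → z ∈ₑ lookup M i ⊎ z ∈ₑ lookup M j) (a ∷ s ∷ b ∷ [])
  path-in-e∪f = inj₁ a∈e ∷ inj₁ s∈e ∷ inj₂ b∈f ∷ []

  path-avoids-R : Disjoint (a ∷ s ∷ b ∷ []) (verts R)
  path-avoids-R (z∈path , z∈verts) with g , g∈R , z∈g ← ∈-verts⁻ z∈verts =
    R-avoids-e∪f g∈R z∈g (All.lookup path-in-e∪f z∈path)

-- 1-nearly edge independent sets from the forest

module _ {n : ℕ} where

  pairs : List (Fin n) → List (Edge n)
  pairs (x ∷ y ∷ W) = edge x y ∷ pairs W
  pairs _           = []

  length-pairs : ∀ W → length (pairs W) ≡ ⌊ length W /2⌋
  length-pairs []          = refl
  length-pairs (_ ∷ [])    = refl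
  length-pairs (_ ∷ _ ∷ W) = cong suc (length-pairs W)

  ∈ₑ-pairs : ∀ {W g z} → g ∈ pairs W → z ∈ₑ g → z ∈ W
  ∈ₑ-pairs {x ∷ y ∷ _} (here refl) z∈g = Sum.[ here , there ∘ here ]′ (∈ₑ-edge⁻ x y z∈g)
  ∈ₑ-pairs {_ ∷ _ ∷ _} (there g∈)  z∈g = there (there (∈ₑ-pairs g∈ z∈g))

  edge-avoids : ∀ {W} x y → x ∉ W → y ∉ W → ∀ {z : Fin n} → z ∈ₑ edge x y → z ∉ W
  edge-avoids x y x∉W y∉W z∈e with ∈ₑ-edge⁻ x y z∈e
  ... | inj₁ refl = x∉W
  ... | inj₂ refl = y∉W

  ∉-pairs : ∀ {W e} → (∀ {z : Fin n} → z ∈ₑ e → z ∉ W) → e ∉ pairs W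
  ∉-pairs avoids e∈ = avoids (inj₁ refl) (∈ₑ-pairs e∈ (inj₁ refl))

  ¬adjacent-pairs : ∀ {W e g} → (∀ {z : Fin n} → z ∈ₑ e → z ∉ W) → g ∈ pairs W → ¬ AdjacentEdges e g
  ¬adjacent-pairs avoids g∈ e~g with z , z∈e , z∈g ← adjacent⇒shared e~g = avoids z∈e (∈ₑ-pairs g∈ z∈g)

  pairs-unique : ∀ {W} → Unique W → Unique (pairs W)
  pairs-unique {[]}        _ = []
  pairs-unique {_ ∷ []}    _ = []
  pairs-unique {x ∷ y ∷ W} ((_ ∷ x≢W) ∷ y≢W ∷ W-unique) =
    ¬Any⇒All¬ (pairs W) (∉-pairs (edge-avoids x y (All¬⇒¬Any x≢W) (All¬⇒¬Any y≢W))) ∷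
    pairs-unique W-unique

  pairs-matching : ∀ {W} → Unique W → IsMatching (pairs W)
  pairs-matching {_ ∷ _ ∷ W} _ (here refl) (here refl) g~h = proj₁ g~h refl
  pairs-matching {x ∷ y ∷ W} ((_ ∷ x≢W) ∷ y≢W ∷ _) (here refl) (there h∈) =
    ¬adjacent-pairs (edge-avoids x y (All¬⇒¬Any x≢W) (All¬⇒¬Any y≢W)) h∈
  pairs-matching {x ∷ y ∷ W} ((_ ∷ x≢W) ∷ y≢W ∷ _) (there g∈) (here refl) =
    ¬adjacent-pairs (edge-avoids x y (All¬⇒¬Any x≢W) (All¬⇒¬Any y≢W)) g∈ ∘ adjacent-sym
  pairs-matching {_ ∷ _ ∷ W} (_ ∷ _ ∷ W-unique) (there g∈) (there h∈) = pairs-matching W-unique g∈ h∈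

  pairs-edges : (G : Graph n) {W : List (Fin n)} → Unique W → PairedBy (Adj G) W →
    All (IsEdgeOf G) (pairs W)
  pairs-edges G {[]}        _                           _                  = []
  pairs-edges G {_ ∷ []}    _                           _                  = []
  pairs-edges G {_ ∷ _ ∷ W} ((x≢y ∷ _) ∷ _ ∷ W-unique) (x~y , W-paired) =
    edge-isEdge G x≢y x~y ∷ pairs-edges G W-unique W-paired

  exactlyOneAdjacentPair-∷∷ : ∀ {e f : Edge n} {R} → AdjacentEdges e f →
    (∀ {g h} → g ∈ e ∷ f ∷ R → h ∈ R → ¬ AdjacentEdges g h) → ExactlyOneAdjacentPair (e ∷ f ∷ R)
  exactlyOneAdjacentPair-∷∷ {e} {f} {R} e~f R-isolated = zero , suc zero , z<s , e~f , only
    where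
    only : ∀ i j → toℕ i < toℕ j → AdjacentEdges (lookup (e ∷ f ∷ R) i) (lookup (e ∷ f ∷ R) j) →
           i ≡ zero × j ≡ suc zero
    only zero          (suc zero)    _        _   = refl , refl
    only i             (suc (suc j)) _        g~h = contradiction g~h (R-isolated (∈-lookup i) (∈-lookup j))
    only zero          zero          ()
    only (suc zero)    zero          ()
    only (suc zero)    (suc zero)    (s≤s ())
    only (suc (suc _)) zero          ()
    only (suc (suc _)) (suc zero)    (s≤s ())

  forestAlong⇒nearlyIndep : (G : Graph n) {L : List (Fin n)} → Unique L → ForestAlong (Adj G) L →
    ∃[ M ] NearlyIndep G M × length M ≡ ⌊ suc (length L) /2⌋
  forestAlong⇒nearlyIndep G {a ∷ s ∷ b ∷ W}
    ((a≢s ∷ a≢b ∷ a≢W) ∷ (s≢b ∷ s≢W) ∷ b≢W ∷ W-unique) (a~s , s~b , W-paired) =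
    e ∷ f ∷ pairs W ,
    ((edge-isEdge G a≢s a~s ∷ edge-isEdge G s≢b s~b ∷ pairs-edges G W-unique W-paired , M-unique) ,
     exactlyOneAdjacentPair-∷∷ e~f isolated) ,
    cong (2 +_) (length-pairs W)
    where
    e = edge a s
    f = edge s b

    e-avoids : ∀ {z} → z ∈ₑ e → z ∉ W
    e-avoids = edge-avoids a s (All¬⇒¬Any a≢W) (All¬⇒¬Any s≢W)

    f-avoids : ∀ {z} → z ∈ₑ f → z ∉ W
    f-avoids = edge-avoids s b (All¬⇒¬Any s≢W) (All¬⇒¬Any b≢W)

    e≢f : e ≢ f
    e≢f e≡f = Sum.[ a≢s , a≢b ]′ (∈ₑ-edge⁻ s b (subst (a ∈ₑ_) e≡f (∈ₑ-edge⁺ a s (inj₁ refl))))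

    e~f : AdjacentEdges e f
    e~f = shared⇒adjacent e≢f (∈ₑ-edge⁺ a s (inj₂ refl)) (∈ₑ-edge⁺ s b (inj₁ refl))

    M-unique : Unique (e ∷ f ∷ pairs W)
    M-unique =
      (e≢f ∷ ¬Any⇒All¬ _ (∉-pairs e-avoids)) ∷ ¬Any⇒All¬ _ (∉-pairs f-avoids) ∷ pairs-unique W-unique

    isolated : ∀ {g h} → g ∈ e ∷ f ∷ pairs W → h ∈ pairs W → ¬ AdjacentEdges g h
    isolated (here refl)         = ¬adjacent-pairs e-avoids
    isolated (there (here refl)) = ¬adjacent-pairs f-avoids
    isolated (there (there g∈))  = pairs-matching W-unique g∈

-- The bound and its equality case

⌊m/2⌋≡⌊n/2⌋∧m≤n⇒n≤1+m : ∀ {m n} → ⌊ m /2⌋ ≡ ⌊ n /2⌋ → m ≤ n → n ≤ suc m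
⌊m/2⌋≡⌊n/2⌋∧m≤n⇒n≤1+m {0}           {0}           _  _                  = z≤n
⌊m/2⌋≡⌊n/2⌋∧m≤n⇒n≤1+m {0}           {1}           _  _                  = s≤s z≤n
⌊m/2⌋≡⌊n/2⌋∧m≤n⇒n≤1+m {1}           {1}           _  _                  = s≤s z≤n
⌊m/2⌋≡⌊n/2⌋∧m≤n⇒n≤1+m {1}           {2}           _  _                  = s≤s (s≤s z≤n)
⌊m/2⌋≡⌊n/2⌋∧m≤n⇒n≤1+m {suc (suc m)} {suc (suc n)} eq (s≤s (s≤s m≤n)) =
  s≤s (s≤s (⌊m/2⌋≡⌊n/2⌋∧m≤n⇒n≤1+m (ℕ.suc-injective eq) m≤n))
⌊m/2⌋≡⌊n/2⌋∧m≤n⇒n≤1+m {0}           {suc (suc n)} ()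
⌊m/2⌋≡⌊n/2⌋∧m≤n⇒n≤1+m {1}           {suc (suc (suc n))} ()

module _ {n : ℕ} where

  extend-to-length : {L : List (Fin n)} → Unique L → length L ≤ n → n ≤ suc (length L) →
    ∃[ ys ] length ys ≤ 1 × Unique (L ++ ys) × length (L ++ ys) ≡ n
  extend-to-length {L} L-unique ℓ≤n n≤1+ℓ with ℕ.m≤n⇒m<n∨m≡n ℓ≤n
  ... | inj₂ ℓ≡n =
    [] , z≤n , subst Unique (sym (++-identityʳ L)) L-unique , trans (cong length (++-identityʳ L)) ℓ≡n
  ... | inj₁ ℓ<n with x , x∉L ← length<⇒∃∉ ℓ<n =
    [ x ] , s≤s z≤n , ++⁺ L-unique ([] ∷ []) (λ { (x∈L , here refl) → x∉L x∈L ; (_ , there ()) }) ,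
    trans (length-++ L) (trans (ℕ.+-comm (length L) 1) (ℕ.≤-antisym ℓ<n n≤1+ℓ))

module _ {n : ℕ} (G : Graph n) {M : List (Edge n)} (M-indep : NearlyIndep G M) where

  open PathAndMatching (decompose {G = G} M-indep)

  length-spine≤n : length spine ≤ n
  length-spine≤n = unique⇒length≤ spine-unique

  nearlyIndep-bound : length M ≤ ⌊ suc n /2⌋
  nearlyIndep-bound =
    subst (_≤ ⌊ suc n /2⌋) (sym length-M≡⌊1+spine/2⌋) (ℕ.⌊n/2⌋-mono (s≤s length-spine≤n))

  -- At equality at most one vertex lies off the spine; appended, it becomes the isolated K₁.
  nearlyIndep-tight⇒faithful : length M ≡ ⌊ suc n /2⌋ → Faithful G
  nearlyIndep-tight⇒faithful tight
    with ys , short , L-unique , full ← extend-to-length spine-unique length-spine≤n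
           (ℕ.≤-pred (⌊m/2⌋≡⌊n/2⌋∧m≤n⇒n≤1+m
             (trans (sym length-M≡⌊1+spine/2⌋) tight) (s≤s length-spine≤n)))
    = forestAlong⇒faithful G L-unique full
        (a~s , s~b , pairedBy-verts-++ R-edges (pairedBy-short short))

faithful⇒nearlyIndep : ∀ {n} (G : Graph n) → Faithful G →
  ∃[ M ] NearlyIndep G M × length M ≡ ⌊ suc n /2⌋
faithful⇒nearlyIndep G faithful
  with L , L-unique , full , along ← faithful⇒forestAlong G faithful
  with M , M-indep , size ← forestAlong⇒nearlyIndep G L-unique along
  = M , M-indep , trans size (cong (λ ℓ → ⌊ suc ℓ /2⌋) full)

theorem3p2 : (n : ℕ) → 1 ≤ n → (G : Graph n) → (k : ℕ) → IsAlpha1 G k →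
    (k ≤ ⌊ n + 1 /2⌋) × ((k ≡ ⌊ n + 1 /2⌋) ⇔ Faithful G)
theorem3p2 n 1≤n G k α rewrite ℕ.+-comm n 1 with α
... | inj₁ (M , M-indep , refl , maximum) =
  nearlyIndep-bound G M-indep ,
  mk⇔ (nearlyIndep-tight⇒faithful G M-indep) λ faithful →
    let M′ , M′-indep , M′-size = faithful⇒nearlyIndep G faithful
    in ℕ.≤-antisym (nearlyIndep-bound G M-indep) (subst (_≤ length M) M′-size (maximum M′ M′-indep))
... | inj₂ (none , refl) =
  z≤n ,
  mk⇔ (λ 0≡⌊n+1/2⌋ → contradiction 0≡⌊n+1/2⌋ (ℕ.<⇒≢ (ℕ.⌊n/2⌋-mono (s≤s 1≤n))))
      (λ faithful → contradiction (proj₁ (proj₂ (faithful⇒nearlyIndep G faithful))) (none _))
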